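{- Let $1\le h\le n$ and set $j=\overline{v}_p(h)$. Then $v_L(c_h)\ge i_j^{\pi_L}+h$, with equality if and only if either $i_j^{\pi_L}=\infty$, or $i_j^{\pi_L}<\infty$ and $h=b_j$.
   Context: $K$ is a field complete with respect to a discrete valuation $v_K$ with perfect residue field of characteristic $p$; $L/K$ is a finite separable totally ramified extension of degree $n=up^\nu$ with $p\nmid u$; $v_L$ is the normalized valuation of $L$ (so $v_L=nv_K$ on $K$). $\pi_L$ is a uniformizer of $L$ with minimal polynomial $f(X)=X^n-c_1X^{n-1}+\dots+(-1)^{n-1}c_{n-1}X+(-1)^nc_n$ over $K$. For $k\in\mathbb{Z}$, $\overline{v}_p(k)=\min\{v_p(k),\nu\}$. For $0\le j\le\nu$, $i_j^{\pi_L}=\min\{nv_K(c_h)-h:1\le h\le n,\ \overline{v}_p(h)\le j\}$ (a nonnegative integer or $\infty$). When $i_j^{\pi_L}$ is finite, write $i_j^{\pi_L}=a_jn-b_j$ with $a_j\in\mathbb{Z}$ and $1\le b_j\le n$. -}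

module Defs where

open import Data.Nat as ℕ using (ℕ; zero; suc; _^_)
open import Data.Nat.Divisibility using (_∣?_)
open import Data.Integer as ℤ using (ℤ; +_)
open import Data.Bool using (true; false; if_then_else_)
open import Relation.Nullary using (does)

-- Extended integers ℤ ∪ {∞}  (valuations of field elements; ∞ = valuation of 0).
data ℤ∞ : Set where
  fin : ℤ → ℤ∞
  ∞   : ℤ∞

infix 4 _≤∞_
data _≤∞_ : ℤ∞ → ℤ∞ → Set where
  fin≤fin : ∀ {x y} → x ℤ.≤ y → fin x ≤∞ fin y
  _≤∞∞    : ∀ x → x ≤∞ ∞

min∞ : ℤ∞ → ℤ∞ → ℤ∞
min∞ (fin x) (fin y) = fin (x ℤ.⊓ y)
min∞ (fin x) ∞       = fin x
min∞ ∞       y       = y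

infixl 6 _+∞_
_+∞_ : ℤ∞ → ℤ → ℤ∞
fin x +∞ k = fin (x ℤ.+ k)
∞     +∞ k = ∞

_·∞_ : ℕ → ℤ∞ → ℤ∞
n ·∞ fin x = fin (+ n ℤ.* x)
n ·∞ ∞     = ∞

-- v̄_p(k) = min{v_p(k), ν} for k ≥ 1, computed as the largest j ≤ ν with p^j ∣ k.
-- vbarAux p k j = largest i ≤ j with p^i ∣ k.
vbarAux : ℕ → ℕ → ℕ → ℕ
vbarAux p k zero    = zero
vbarAux p k (suc j) = if does ((p ^ suc j) ∣? k) then suc j else vbarAux p k j

vbar : (p ν k : ℕ) → ℕ
vbar p ν k = vbarAux p k ν

-- Given vK h = v_K(c_h) (the K-valuation of the coefficient c_h of the minimal
-- polynomial of π_L), the L-valuation v_L(c_h) = n · v_K(c_h).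
vL : (n : ℕ) (vK : ℕ → ℤ∞) → ℕ → ℤ∞
vL n vK h = n ·∞ vK h

iTerm : (p ν n : ℕ) (vK : ℕ → ℤ∞) (j h : ℕ) → ℤ∞
iTerm p ν n vK j h =
  if does (vbar p ν h ℕ.≤? j) then (vL n vK h +∞ (ℤ.- (+ h))) else ∞

iMin : (p ν n : ℕ) (vK : ℕ → ℤ∞) (j m : ℕ) → ℤ∞
iMin p ν n vK j zero    = ∞
iMin p ν n vK j (suc m) = min∞ (iTerm p ν n vK j (suc m)) (iMin p ν n vK j m)

-- i_j^{π_L} = min { n v_K(c_h) − h : 1 ≤ h ≤ n, v̄_p(h) ≤ j }
iJ : (p ν n : ℕ) (vK : ℕ → ℤ∞) (j : ℕ) → ℤ∞
iJ p ν n vK j = iMin p ν n vK j n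

-- The bound is just that i_j is a minimum over a set containing the term n v_K(c_h) − h.
-- For equality, suppose i_j = a n − h is finite; it is attained at some h′, i.e.
-- i_j = n v_K(c_{h′}) − h′.  Then h ≡ h′ (mod n), and as both lie in [1, n] they coincide,
-- so the term for h itself realises the minimum.  Conversely equality means i_j is the
-- term n v_K(c_h) − h, which has the required shape with b = h.
module Submission where

open import Defs
open import Data.Nat as ℕ using (ℕ; _^_; _*_; _≤_)
open import Data.Nat.Divisibility using (_∣_)
open import Data.Nat.Primality using (Prime)
import Data.Nat.Properties as ℕ
open import Data.Integer as ℤ using (ℤ; +_; -[1+_])
import Data.Integer.Properties as ℤ
open import Data.Integer.Tactic.RingSolver using (solve-∀)
open import Data.Product using (Σ; _×_; _,_)
open import Data.Sum using (_⊎_; inj₁; inj₂)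
open import Data.Empty using (⊥-elim)
open import Relation.Binary.PropositionalEquality
  using (_≡_; _≢_; refl; sym; trans; cong; subst; module ≡-Reasoning)
open import Relation.Nullary using (¬_; yes; no; does)
open import Data.Bool using (true; false)
open import Relation.Nullary.Decidable using (dec-true)
open import Function.Bundles using (_⇔_; mk⇔)

≤∞-refl : ∀ x → x ≤∞ x
≤∞-refl (fin x) = fin≤fin ℤ.≤-refl
≤∞-refl ∞       = ∞ ≤∞∞

≤∞-trans : ∀ {x y z} → x ≤∞ y → y ≤∞ z → x ≤∞ z
≤∞-trans (fin≤fin x≤y) (fin≤fin y≤z) = fin≤fin (ℤ.≤-trans x≤y y≤z)
≤∞-trans _             (y ≤∞∞)       = _ ≤∞∞

fin-injective : ∀ {x y} → fin x ≡ fin y → x ≡ y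
fin-injective refl = refl

min∞-≤ˡ : ∀ x y → min∞ x y ≤∞ x
min∞-≤ˡ (fin x) (fin y) = fin≤fin (ℤ.i⊓j≤i x y)
min∞-≤ˡ (fin x) ∞       = ≤∞-refl (fin x)
min∞-≤ˡ ∞       y       = y ≤∞∞

min∞-≤ʳ : ∀ x y → min∞ x y ≤∞ y
min∞-≤ʳ (fin x) (fin y) = fin≤fin (ℤ.i⊓j≤j x y)
min∞-≤ʳ (fin x) ∞       = fin x ≤∞∞
min∞-≤ʳ ∞       y       = ≤∞-refl y

min∞-sel : ∀ x y → min∞ x y ≡ x ⊎ min∞ x y ≡ y
min∞-sel (fin x) (fin y) with ℤ.⊓-sel x y
... | inj₁ eq = inj₁ (cong fin eq)
... | inj₂ eq = inj₂ (cong fin eq)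
min∞-sel (fin x) ∞       = inj₁ refl
min∞-sel ∞       y       = inj₂ refl

-+-cancel : ∀ x k → x ℤ.- k ℤ.+ k ≡ x
-+-cancel = solve-∀

+∞-≤-transpose : ∀ x y k → x ≤∞ y +∞ (ℤ.- k) → x +∞ k ≤∞ y
+∞-≤-transpose (fin a) (fin b) k (fin≤fin a≤b-k) =
  fin≤fin (subst (a ℤ.+ k ℤ.≤_) (-+-cancel b k) (ℤ.+-monoˡ-≤ k a≤b-k))
+∞-≤-transpose x       ∞       k _  = _ ≤∞∞

∞-≤-+∞ : ∀ x k → ∞ ≤∞ x +∞ k → x ≡ ∞
∞-≤-+∞ ∞ k _ = refl

iMin-≤-iTerm : ∀ p ν n vK j m h → 1 ≤ h → h ≤ m → iMin p ν n vK j m ≤∞ iTerm p ν n vK j h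
iMin-≤-iTerm p ν n vK j ℕ.zero    (ℕ.suc h) _ ()
iMin-≤-iTerm p ν n vK j (ℕ.suc m) h 1≤h h≤1+m with h ℕ.≟ ℕ.suc m
... | yes refl = min∞-≤ˡ (iTerm p ν n vK j (ℕ.suc m)) (iMin p ν n vK j m)
... | no h≢1+m =
  ≤∞-trans (min∞-≤ʳ (iTerm p ν n vK j (ℕ.suc m)) (iMin p ν n vK j m))
           (iMin-≤-iTerm p ν n vK j m h 1≤h (ℕ.s≤s⁻¹ (ℕ.≤∧≢⇒< h≤1+m h≢1+m)))

iMin-attained : ∀ p ν n vK j m x → iMin p ν n vK j m ≡ fin x →
                Σ ℕ λ h → 1 ≤ h × h ≤ m × iTerm p ν n vK j h ≡ fin x
iMin-attained p ν n vK j ℕ.zero    x ()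
iMin-attained p ν n vK j (ℕ.suc m) x eq
  with min∞-sel (iTerm p ν n vK j (ℕ.suc m)) (iMin p ν n vK j m)
... | inj₁ isTerm = ℕ.suc m , ℕ.s≤s ℕ.z≤n , ℕ.≤-refl , trans (sym isTerm) eq
... | inj₂ isMin with iMin-attained p ν n vK j m x (trans (sym isMin) eq)
...   | h , 1≤h , h≤m , attained = h , 1≤h , ℕ.m≤n⇒m≤1+n h≤m , attained

iTerm-of-vbar≤ : ∀ p ν n vK j h → vbar p ν h ≤ j →
                 iTerm p ν n vK j h ≡ vL n vK h +∞ (ℤ.- (+ h))
iTerm-of-vbar≤ p ν n vK j h vbar≤j rewrite dec-true (vbar p ν h ℕ.≤? j) vbar≤j = refl

iTerm-fin : ∀ p ν n vK j h x → iTerm p ν n vK j h ≡ fin x →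
            Σ ℤ λ c → vK h ≡ fin c × x ≡ + n ℤ.* c ℤ.- + h
iTerm-fin p ν n vK j h x eq with does (vbar p ν h ℕ.≤? j) | vK h
... | true  | fin c with eq
...   | refl = c , refl , refl
iTerm-fin p ν n vK j h x () | true  | ∞
iTerm-fin p ν n vK j h x () | false | _

iJ-≤-term : ∀ p ν n vK h → 1 ≤ h → h ≤ n →
            iJ p ν n vK (vbar p ν h) ≤∞ vL n vK h +∞ (ℤ.- (+ h))
iJ-≤-term p ν n vK h 1≤h h≤n =
  subst (iJ p ν n vK j ≤∞_) (iTerm-of-vbar≤ p ν n vK j h ℕ.≤-refl)
        (iMin-≤-iTerm p ν n vK j n h 1≤h h≤n)
  where j = vbar p ν h

n<b+[1+k]*n : ∀ b n k → 1 ≤ b → n ℕ.< b ℕ.+ ℕ.suc k * n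
n<b+[1+k]*n b n k 1≤b = ℕ.+-mono-≤ 1≤b (ℕ.m≤m+n n (k * n))

shift-out-of-range : ∀ b b′ n k → 1 ≤ b → b′ ≤ n → + b ℤ.+ + ℕ.suc k ℤ.* + n ≢ + b′
shift-out-of-range b b′ n k 1≤b b′≤n eq =
  ℕ.<⇒≱ (n<b+[1+k]*n b n k 1≤b) (subst (_≤ n) (sym (ℤ.+-injective eq′)) b′≤n)
  where
  open ≡-Reasoning
  eq′ : + (b ℕ.+ ℕ.suc k * n) ≡ + b′
  eq′ = begin
    + (b ℕ.+ ℕ.suc k * n)          ≡⟨ ℤ.pos-+ b (ℕ.suc k * n) ⟩
    + b ℤ.+ + (ℕ.suc k * n)        ≡⟨ cong (ℤ._+_ (+ b)) (ℤ.pos-* (ℕ.suc k) n) ⟩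
    + b ℤ.+ + ℕ.suc k ℤ.* + n      ≡⟨ eq ⟩
    + b′                           ∎

representative-unique : ∀ {n b b′} (a a′ : ℤ) → 1 ≤ b → b ≤ n → 1 ≤ b′ → b′ ≤ n →
                        a ℤ.* + n ℤ.- + b ≡ a′ ℤ.* + n ℤ.- + b′ → b ≡ b′
representative-unique {n} {b} {b′} a a′ 1≤b b≤n 1≤b′ b′≤n eq = by-shift (a′ ℤ.- a) shift
  where
  open ≡-Reasoning
  shift : + b ℤ.+ (a′ ℤ.- a) ℤ.* + n ≡ + b′
  shift = begin
    + b ℤ.+ (a′ ℤ.- a) ℤ.* + n
      ≡⟨ regroup (+ b) (+ b′) a a′ (+ n) ⟩
    + b′ ℤ.+ ((a′ ℤ.* + n ℤ.- + b′) ℤ.- (a ℤ.* + n ℤ.- + b))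
      ≡⟨ cong (λ z → + b′ ℤ.+ ((a′ ℤ.* + n ℤ.- + b′) ℤ.- z)) eq ⟩
    + b′ ℤ.+ ((a′ ℤ.* + n ℤ.- + b′) ℤ.- (a′ ℤ.* + n ℤ.- + b′))
      ≡⟨ cancel (+ b′) (a′ ℤ.* + n ℤ.- + b′) ⟩
    + b′ ∎
    where
    regroup : ∀ b b′ a a′ n → b ℤ.+ (a′ ℤ.- a) ℤ.* n ≡ b′ ℤ.+ ((a′ ℤ.* n ℤ.- b′) ℤ.- (a ℤ.* n ℤ.- b))
    regroup = solve-∀
    cancel : ∀ x y → x ℤ.+ (y ℤ.- y) ≡ x
    cancel = solve-∀
  flip : ∀ x y m → x ℤ.- m ≡ y → y ℤ.+ m ≡ x
  flip x y m e = trans (cong (ℤ._+ m) (sym e)) (-+-cancel x m)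
  by-shift : ∀ d → + b ℤ.+ d ℤ.* + n ≡ + b′ → b ≡ b′
  by-shift (+ 0)       e = ℤ.+-injective (trans (sym (ℤ.+-identityʳ (+ b))) e)
  by-shift (+ ℕ.suc k) e = ⊥-elim (shift-out-of-range b b′ n k 1≤b b′≤n e)
  by-shift -[1+ k ]    e = ⊥-elim (shift-out-of-range b′ b n k 1≤b′ b≤n
    (flip (+ b) (+ b′) (+ ℕ.suc k ℤ.* + n) (trans (cong (ℤ._+_ (+ b)) (ℤ.neg-distribˡ-* (+ ℕ.suc k) (+ n))) e)))

EqualityCase : ℕ → ℕ → ℤ∞ → Set
EqualityCase n h i =
  i ≡ ∞ ⊎ Σ ℤ (λ x → i ≡ fin x
    × Σ ℤ (λ a → Σ ℕ (λ b → x ≡ (a ℤ.* (+ n)) ℤ.- (+ b)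
      × 1 ≤ b × b ≤ n × h ≡ b)))

equalityCase-of-≡ : ∀ n h w i → 1 ≤ h → h ≤ n → n ·∞ w ≡ i +∞ (+ h) → EqualityCase n h i
equalityCase-of-≡ n h w       ∞       _   _   _  = inj₁ refl
equalityCase-of-≡ n h (fin c) (fin x) 1≤h h≤n eq =
  inj₂ (x , refl , c , h , x≡c*n-h , 1≤h , h≤n , refl)
  where
  open ≡-Reasoning
  x≡c*n-h : x ≡ c ℤ.* + n ℤ.- + h
  x≡c*n-h = begin
    x                        ≡⟨ sym (-+-cancel′ x (+ h)) ⟩
    x ℤ.+ + h ℤ.- + h        ≡⟨ cong (ℤ._- + h) (sym (fin-injective eq)) ⟩
    + n ℤ.* c ℤ.- + h        ≡⟨ cong (ℤ._- + h) (ℤ.*-comm (+ n) c) ⟩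
    c ℤ.* + n ℤ.- + h        ∎
    where
    -+-cancel′ : ∀ x k → x ℤ.+ k ℤ.- k ≡ x
    -+-cancel′ = solve-∀

iJ-attained-at : ∀ p ν n vK j h a → 1 ≤ h → h ≤ n →
                 iJ p ν n vK j ≡ fin (a ℤ.* + n ℤ.- + h) →
                 vL n vK h ≡ fin (a ℤ.* + n ℤ.- + h) +∞ (+ h)
iJ-attained-at p ν n vK j h a 1≤h h≤n eq
  with iMin-attained p ν n vK j n (a ℤ.* + n ℤ.- + h) eq
... | h′ , 1≤h′ , h′≤n , attained
  with iTerm-fin p ν n vK j h′ (a ℤ.* + n ℤ.- + h) attained
... | c , vK≡c , a*n-h≡n*c-h′
  with representative-unique a c 1≤h h≤n 1≤h′ h′≤n
         (trans a*n-h≡n*c-h′ (cong (ℤ._- + h′) (ℤ.*-comm (+ n) c)))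
... | refl = begin
  n ·∞ vK h                        ≡⟨ cong (n ·∞_) vK≡c ⟩
  fin (+ n ℤ.* c)                  ≡⟨ cong fin (sym (-+-cancel (+ n ℤ.* c) (+ h))) ⟩
  fin (+ n ℤ.* c ℤ.- + h ℤ.+ + h)  ≡⟨ cong (λ z → fin (z ℤ.+ + h)) (sym a*n-h≡n*c-h′) ⟩
  fin (a ℤ.* + n ℤ.- + h ℤ.+ + h)  ∎
  where open ≡-Reasoning

lemma4p1 : (p u ν n : ℕ) → Prime p → ¬ (p ∣ u) → n ≡ u * p ^ ν →
           (vK : ℕ → ℤ∞) → (h : ℕ) → 1 ≤ h → h ≤ n →
           let j = vbar p ν h
               i = iJ p ν n vK j
           in ((i +∞ (+ h)) ≤∞ vL n vK h)
              × ((vL n vK h ≡ (i +∞ (+ h)))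
                 ⇔ (i ≡ ∞
                    ⊎ Σ ℤ (λ x → i ≡ fin x
                      × Σ ℤ (λ a → Σ ℕ (λ b → x ≡ (a ℤ.* (+ n)) ℤ.- (+ b)
                        × 1 ≤ b × b ≤ n × h ≡ b)))))
lemma4p1 p u ν n _ _ _ vK h 1≤h h≤n =
  +∞-≤-transpose i (vL n vK h) (+ h) i≤term ,
  mk⇔ (equalityCase-of-≡ n h (vK h) i 1≤h h≤n) ≡-of-equalityCase
  where
  i = iJ p ν n vK (vbar p ν h)
  i≤term : i ≤∞ vL n vK h +∞ (ℤ.- (+ h))
  i≤term = iJ-≤-term p ν n vK h 1≤h h≤n
  ≡-of-equalityCase : EqualityCase n h i → vL n vK h ≡ i +∞ (+ h)
  ≡-of-equalityCase (inj₁ i≡∞) rewrite i≡∞ = ∞-≤-+∞ (vL n vK h) _ (subst (_≤∞ _) i≡∞ i≤term)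
  ≡-of-equalityCase (inj₂ (x , i≡x , a , _ , refl , _ , _ , refl)) rewrite i≡x =
    iJ-attained-at p ν n vK (vbar p ν h) h a 1≤h h≤n i≡x
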